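{- Let $\mathcal{A}=\{0,\ldots,n-1\}$ for some $n\in\mathbb{N}$, and let $\lceil\cdot\rceil,\lfloor\cdot\rfloor:\mathcal{A}\rightarrow\{0,1\}^*$ be two Deflate codings such that $\operatorname{len}\lceil x\rceil=\operatorname{len}\lfloor x\rfloor$ for all $x\in\mathcal{A}$. Then $\lceil x\rceil=\lfloor x\rfloor$ for all $x\in\mathcal{A}$.
   Context: $\{0,1\}^*$ is the set of finite bit lists, $[\,]$ is the empty list, $::$ is cons, $+\!\!+$ is concatenation, $\{0,1\}^+$ is the set of nonempty bit lists. For bit lists $a,b$, write $a\preccurlyeq b$ ($a$ is a prefix of $b$) if there is $c\in\{0,1\}^*$ with $a+\!\!+c=b$. The lexicographical ordering $\sqsubseteq$ on $\{0,1\}^*$ is the least relation with $[\,]\sqsubseteq a$ for all $a$; $0::a\sqsubseteq 1::b$ for all $a,b$; and $j::a\sqsubseteq j::b$ whenever $a\sqsubseteq b$ (for $j\in\{0,1\}$). A Deflate coding is a map $\lceil\cdot\rceil:\mathcal{A}\to\{0,1\}^*$ such that: (1) for all $a\neq b$ with $\lceil a\rceil\neq[\,]$, $\lceil a\rceil\not\preccurlyeq\lceil b\rceil$; (2) for all $a,b$, if $\operatorname{len}\lceil a\rceil<\operatorname{len}\lceil b\rceil$ then $\lceil a\rceil\sqsubseteq\lceil b\rceil$; (3) for all $a,b$, if $\operatorname{len}\lceil a\rceil=\operatorname{len}\lceil b\rceil$ and $a\le b$ then $\lceil a\rceil\sqsubseteq\lceil b\rceil$; (4) for all $a\in\mathcal{A}$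 and $l\in\{0,1\}^+$, if $l\sqsubseteq\lceil a\rceil$ and $\operatorname{len} l=\operatorname{len}\lceil a\rceil$, then there exists $b\in\mathcal{A}$ with $\lceil b\rceil\neq[\,]$ and $\lceil b\rceil\preccurlyeq l$. -}

module Defs where

open import Data.Bool using (Bool; false; true)
open import Data.List using (List; []; _∷_; _++_; length)
open import Data.Nat using (ℕ; _<_)
open import Data.Fin using (Fin)
open import Data.Fin.Base using () renaming (_≤_ to _≤ᶠ_)
open import Data.Product using (Σ; ∃; _×_)
open import Relation.Nullary using (¬_)
open import Relation.Binary.PropositionalEquality using (_≡_; _≢_)

-- bits: false = 0, true = 1
Bit : Set
Bit = Bool

_≼_ : List Bit → List Bit → Set
a ≼ b = Σ (List Bit) λ c → a ++ c ≡ b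

data _⊑_ : List Bit → List Bit → Set where
  []⊑  : ∀ {a} → [] ⊑ a
  0⊑1  : ∀ {a b} → (false ∷ a) ⊑ (true ∷ b)
  j∷⊑  : ∀ {j a b} → a ⊑ b → (j ∷ a) ⊑ (j ∷ b)

record IsDeflateCoding {n : ℕ} (c : Fin n → List Bit) : Set where
  field
    prefix-free : ∀ a b → a ≢ b → c a ≢ [] → ¬ (c a ≼ c b)
    shorter-⊑   : ∀ a b → length (c a) < length (c b) → c a ⊑ c b
    same-len-⊑  : ∀ a b → length (c a) ≡ length (c b) → a ≤ᶠ b → c a ⊑ c b
    dense       : ∀ a (l : List Bit) → l ≢ [] → l ⊑ c a → length l ≡ length (c a) →
                  ∃ λ b → (c b ≢ []) × (c b ≼ l)

-- Induct along the canonical order: by length, then by symbol. If c x ⊏ d x, the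
-- density of d at x yields a codeword d b that is a prefix of c x. If it is a
-- proper prefix, then b comes earlier, so c b = d b is a proper prefix of c x,
-- contradicting prefix-freeness of c. Otherwise d b = c x has the length of d x:
-- b < x gives c b = c x, again contradicting prefix-freeness, and x < b gives
-- d x ⊑ d b = c x, so c x = d x by antisymmetry.
module Submission where

open import Defs
open import Data.Nat using (ℕ; _<_; z<s)
import Data.Nat.Induction as ℕ
open import Data.Nat.Properties using (m<m+n; <-irrefl; <⇒≤)
open import Data.Fin as Fin using (Fin)
import Data.Fin.Induction as Fin
import Data.Fin.Properties as Fin
open import Data.Bool using (false; true)
open import Data.List using (List; []; _∷_; length)
open import Data.List.Properties using (++-identityʳ; length-++)
open import Data.Product using (_,_)
open import Data.Product.Relation.Binary.Lex.Strict using (×-Lex; ×-wellFounded)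
open import Data.Sum using (_⊎_; inj₁; inj₂; [_,_]′)
open import Data.Empty using (⊥-elim)
open import Function using (_∘_; _on_)
open import Induction.WellFounded using (WellFounded; module All)
import Relation.Binary.Construct.On as On
open import Relation.Binary.Definitions using (tri<; tri≈; tri>)
open import Relation.Binary.PropositionalEquality

⊑-total : ∀ a b → a ⊑ b ⊎ b ⊑ a
⊑-total []          b           = inj₁ []⊑
⊑-total (_ ∷ _)     []          = inj₂ []⊑
⊑-total (false ∷ _) (true ∷ _)  = inj₁ 0⊑1
⊑-total (true ∷ _)  (false ∷ _) = inj₂ 0⊑1
⊑-total (false ∷ a) (false ∷ b) = [ inj₁ ∘ j∷⊑ , inj₂ ∘ j∷⊑ ]′ (⊑-total a b)
⊑-total (true ∷ a)  (true ∷ b)  = [ inj₁ ∘ j∷⊑ , inj₂ ∘ j∷⊑ ]′ (⊑-total a b)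

⊑-antisym : ∀ {a b} → a ⊑ b → b ⊑ a → a ≡ b
⊑-antisym []⊑     []⊑     = refl
⊑-antisym (j∷⊑ p) (j∷⊑ q) = cong (_ ∷_) (⊑-antisym p q)

≼-refl : ∀ (a : List Bit) → a ≼ a
≼-refl a = [] , ++-identityʳ a

≼⇒≡⊎<-length : ∀ {a b} → a ≼ b → a ≡ b ⊎ length a < length b
≼⇒≡⊎<-length {a} ([]    , refl) = inj₁ (sym (++-identityʳ a))
≼⇒≡⊎<-length {a} (_ ∷ _ , refl) = inj₂ (subst (length a <_) (sym (length-++ a)) (m<m+n _ z<s))

length≡0⇒≡[] : ∀ {A : Set} (a : List A) → length a ≡ 0 → a ≡ []
length≡0⇒≡[] [] _ = refl

≡[]⊎≢[] : ∀ {A : Set} (a : List A) → a ≡ [] ⊎ a ≢ []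
≡[]⊎≢[] []      = inj₁ refl
≡[]⊎≢[] (_ ∷ _) = inj₂ λ ()

module CanonicalOrder {n : ℕ} (ℓ : Fin n → ℕ) where

  _≺_ : Fin n → Fin n → Set
  _≺_ = ×-Lex _≡_ _<_ Fin._<_ on λ x → ℓ x , x

  ≺-wellFounded : WellFounded _≺_
  ≺-wellFounded = On.wellFounded _ (×-wellFounded ℕ.<-wellFounded Fin.<-wellFounded)

module _ {n : ℕ} {c d : Fin n → List Bit} (C : IsDeflateCoding c) (D : IsDeflateCoding d)
         (ℓ : Fin n → ℕ) (c-len : ∀ x → length (c x) ≡ ℓ x) (d-len : ∀ x → length (d x) ≡ ℓ x)
         where

  open CanonicalOrder ℓ
  open IsDeflateCoding

  ⊑⇒≡-if-agree-before : ∀ x → (∀ {y} → y ≺ x → c y ≡ d y) → c x ⊑ d x → c x ≡ d x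
  ⊑⇒≡-if-agree-before x before c⊑d with ≡[]⊎≢[] (c x)
  ... | inj₁ cx≡[] =
    trans cx≡[] (sym (length≡0⇒≡[] (d x) (trans (d-len x) (trans (sym (c-len x)) (cong length cx≡[])))))
  ... | inj₂ cx≢[]
    with b , db≢[] , db≼cx ← dense D x (c x) cx≢[] c⊑d (trans (c-len x) (sym (d-len x)))
    with ≼⇒≡⊎<-length db≼cx
  ... | inj₂ db<cx = ⊥-elim (prefix-free C b x b≢x cb≢[] (subst (_≼ c x) (sym cb≡db) db≼cx))
    where
    ℓb<ℓx : ℓ b < ℓ x
    ℓb<ℓx = subst₂ _<_ (d-len b) (c-len x) db<cx
    cb≡db : c b ≡ d b
    cb≡db = before (inj₁ ℓb<ℓx)
    cb≢[] : c b ≢ []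
    cb≢[] = db≢[] ∘ trans (sym cb≡db)
    b≢x : b ≢ x
    b≢x refl = <-irrefl refl ℓb<ℓx
  ... | inj₁ db≡cx with Fin.<-cmp b x
  ...   | tri< b<x _ _ =
    ⊥-elim (prefix-free C x b (Fin.<⇒≢ b<x ∘ sym) cx≢[] (subst (c x ≼_) cx≡cb (≼-refl (c x))))
    where
    cx≡cb : c x ≡ c b
    cx≡cb = trans (sym db≡cx) (sym (before (inj₂ (ℓb≡ℓx , b<x))))
      where
      ℓb≡ℓx : ℓ b ≡ ℓ x
      ℓb≡ℓx = trans (sym (d-len b)) (trans (cong length db≡cx) (c-len x))
  ...   | tri≈ _ refl _ = sym db≡cx
  ...   | tri> _ _ x<b = ⊑-antisym c⊑d (subst (d x ⊑_) db≡cx (same-len-⊑ D x b ℓdx≡ℓdb (<⇒≤ x<b)))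
    where
    ℓdx≡ℓdb : length (d x) ≡ length (d b)
    ℓdx≡ℓdb = trans (d-len x) (trans (sym (c-len x)) (cong length (sym db≡cx)))

theorem1 : (n : ℕ) (c d : Fin n → List Bit) → IsDeflateCoding c → IsDeflateCoding d →
           (∀ x → length (c x) ≡ length (d x)) → ∀ x → c x ≡ d x
theorem1 n c d C D len = All.wfRec ≺-wellFounded _ _ λ x before →
  [ ⊑⇒≡-if-agree-before C D (length ∘ c) (λ _ → refl) (sym ∘ len) x before
  , sym ∘ ⊑⇒≡-if-agree-before D C (length ∘ c) (sym ∘ len) (λ _ → refl) x (sym ∘ before)
  ]′ (⊑-total (c x) (d x))
  where open CanonicalOrder (length ∘ c)
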